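{- For all positive integers $r,n$, \[\sum_{g\in G_{r,n}} q^{\text{flag-major}_F(g)}=\sum_{g\in G_{r,n}} q^{finv_F(g)}.\]
   Context: $G_{r,n}$ is the set of pairs $g=(z,\pi)$ with $z\in\{0,\dots,r-1\}^n$, $\pi\in S_n$ (the wreath product $C_r\wr S_n$); $csum(g)=\sum_i z_i$. The friends order $F$ on letters $i^{[c]}$ ($i^{[0]}=i$) is $1<1^{[1]}<\dots<1^{[r-1]}<2<\dots<2^{[r-1]}<\dots<n<\dots<n^{[r-1]}$. $maj_F(g)=\sum\{1\le i\le n-1:\pi(i)^{[z_i]}>_F\pi(i+1)^{[z_{i+1}]}\}$, $inv_F(g)=|\{i<j:\pi(i)^{[z_i]}>_F\pi(j)^{[z_j]}\}|$, $\text{flag-major}_F(g)=r\,maj_F(g)+csum(g)$, $finv_F(g)=r\,inv_F(g)+csum(g)$. -}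

module Defs where

open import Data.Nat using (ℕ; zero; suc; _+_; _*_; _<ᵇ_; _≡ᵇ_)
open import Data.Bool using (Bool; _∧_; _∨_; if_then_else_)
open import Data.List using (List; []; _∷_; map; concatMap; upTo; zip)
open import Data.Nat.ListAction using (sum)
open import Data.Product using (_×_; _,_; proj₁; proj₂)

-- A colored letter i^[c] is the pair (i , c).
Letter : Set
Letter = ℕ × ℕ

-- The friends order F: 1 < 1^[1] < ... < 1^[r-1] < 2 < ... , i.e. lexicographic
-- order on (i , c).  x >F y :
_>F_ : Letter → Letter → Bool
(a , c) >F (b , d) = (b <ᵇ a) ∨ ((a ≡ᵇ b) ∧ (d <ᵇ c))

insertions : ℕ → List ℕ → List (List ℕ)
insertions x [] = (x ∷ []) ∷ []
insertions x (y ∷ ys) = (x ∷ y ∷ ys) ∷ map (y ∷_) (insertions x ys)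

-- All permutations of the list [1 , ... , n], written in one-line notation
-- π(1) π(2) ... π(n); this is S_n.
perms : ℕ → List (List ℕ)
perms zero = [] ∷ []
perms (suc n) = concatMap (insertions (suc n)) (perms n)

colorings : ℕ → ℕ → List (List ℕ)
colorings r zero = [] ∷ []
colorings r (suc n) = concatMap (λ c → map (c ∷_) (colorings r n)) (upTo r)

-- The elements of G_{r,n} = C_r ≀ S_n, g = (z , π), as the colored word
-- π(1)^[z_1] ... π(n)^[z_n].
G : ℕ → ℕ → List (List Letter)
G r n = concatMap (λ π → map (λ z → zip π z) (colorings r n)) (perms n)

csum : List Letter → ℕ
csum w = sum (map proj₂ w)

-- sum of descent positions i (1-indexed), starting at position k
majFrom : ℕ → List Letter → ℕ
majFrom k [] = 0
majFrom k (x ∷ []) = 0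
majFrom k (x ∷ y ∷ w) = (if x >F y then k else 0) + majFrom (suc k) (y ∷ w)

majF : List Letter → ℕ
majF w = majFrom 1 w

invF : List Letter → ℕ
invF [] = 0
invF (x ∷ w) = countBelow x w + invF w
  where
  countBelow : Letter → List Letter → ℕ
  countBelow x [] = 0
  countBelow x (y ∷ ys) = (if x >F y then 1 else 0) + countBelow x ys

flagMajorF : ℕ → List Letter → ℕ
flagMajorF r w = r * majF w + csum w

finvF : ℕ → List Letter → ℕ
finvF r w = r * invF w + csum w

countB : {A : Set} → (A → Bool) → List A → ℕ
countB p [] = 0
countB p (x ∷ xs) = (if p x then 1 else 0) + countB p xs

-- Coefficient of q^k in the generating polynomial  Σ_{g ∈ G_{r,n}} q^{stat(g)}.
genCoeff : ℕ → ℕ → (List Letter → ℕ) → ℕ → ℕ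
genCoeff r n stat k = countB (λ g → stat g ≡ᵇ k) (G r n)

{-# OPTIONS --safe #-}
module Submission where

-- On a colored word whose letters have distinct values the friends order only
-- compares values, so flag-major(z, π) = r·maj(π) + csum(z) and
-- finv(z, π) = r·inv(π) + csum(z); the theorem thus reduces to MacMahon's
-- equidistribution of maj and inv on S_n.  Both are Mahonian: inserting n + 1
-- into the n + 1 slots of π ∈ S_n raises each of them by 0, 1, …, n exactly
-- once.  For inv the raise is the number of letters that n + 1 precedes; for
-- maj it follows from tracking the pair (maj, des) over the slots behind the
-- first letter, by induction on π.

open import Defs
open import Data.Nat using (ℕ; NonZero)
open import Relation.Binary.PropositionalEquality using (_≡_)

open import Data.Bool using (Bool; true; false; not; if_then_else_)
open import Data.Bool.Properties using (∨-identityʳ)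
open import Data.List
  using (List; []; _∷_; _++_; [_]; map; concat; concatMap; length; zip; upTo; applyDownFrom)
open import Data.List.Properties
  using (map-∘; map-++; map-cong-local; map-concatMap; concatMap-map; ++-assoc; length-applyDownFrom)
open import Data.List.Relation.Unary.All using (All; []; _∷_)
import Data.List.Relation.Unary.All as All
import Data.List.Relation.Unary.All.Properties as All
open import Data.List.Relation.Unary.Unique.Propositional using (Unique; _∷_)
import Data.List.Relation.Unary.Unique.Propositional.Properties as Unique
open import Data.List.Relation.Binary.Permutation.Propositional
  using (_↭_; refl; prep; swap; trans; ↭-sym; ↭-trans; ↭-reflexive; ↭⇒↭ₛ;
         module PermutationReasoning)
open import Data.List.Relation.Binary.Permutation.Propositional.Properties
  using (++⁺ˡ; ++⁺ʳ; shift; shifts; ∷↭∷ʳ; map⁺; All-resp-↭; ↭-length)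
open import Data.Nat using (zero; suc; _+_; _*_; _<_; _<ᵇ_; _≡ᵇ_; s≤s)
open import Data.Nat.ListAction using (sum)
open import Data.Nat.ListAction.Properties using (sum-↭)
open import Data.Nat.Properties
  using (+-suc; +-comm; +-assoc; +-identityʳ; +-cancelʳ-≡; suc-injective;
         <⇒≯; <⇒≢; <ᵇ-reflects-<; ≡ᵇ⇒≡; ≡⇒≡ᵇ)
open import Data.Product using (_×_; _,_; proj₁; proj₂)
open import Function using (_∘_)
open import Relation.Binary.PropositionalEquality
  using (refl; sym; cong; cong₂; subst; setoid; _≢_; module ≡-Reasoning)
  renaming (trans to ≡-trans)
open import Data.List.Relation.Binary.Permutation.Setoid.Properties (setoid ℕ)
  using (Unique-resp-↭)
open import Relation.Nullary.Reflects using (ofʸ; ofⁿ; det; fromEquivalence)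

_>ᵇ_ : ℕ → ℕ → Bool
a >ᵇ b = b <ᵇ a

𝟙 : Bool → ℕ
𝟙 b = if b then 1 else 0

>ᵇ-true : ∀ {x y} → y < x → x >ᵇ y ≡ true
>ᵇ-true {x} {y} y<x = det (<ᵇ-reflects-< y x) (ofʸ y<x)

>ᵇ-false : ∀ {x y} → y < x → y >ᵇ x ≡ false
>ᵇ-false {x} {y} y<x = det (<ᵇ-reflects-< x y) (ofⁿ (<⇒≯ y<x))

≡ᵇ-false : ∀ {a b} → a ≢ b → (a ≡ᵇ b) ≡ false
≡ᵇ-false {a} {b} a≢b = det (fromEquivalence (≡ᵇ⇒≡ a b) (≡⇒≡ᵇ a b)) (ofⁿ a≢b)

module _ {A : Set} where

  countB-map : ∀ {B : Set} (p : B → Bool) (f : A → B) xs →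
               countB p (map f xs) ≡ countB (p ∘ f) xs
  countB-map p f [] = refl
  countB-map p f (x ∷ xs) = cong (𝟙 (p (f x)) +_) (countB-map p f xs)

  countB-cong-local : ∀ {p q : A → Bool} {xs} →
                      All (λ x → p x ≡ q x) xs → countB p xs ≡ countB q xs
  countB-cong-local [] = refl
  countB-cong-local (px≡qx ∷ ps) = cong₂ (λ b c → 𝟙 b + c) px≡qx (countB-cong-local ps)

  countB≡sum : ∀ (p : A → Bool) xs → countB p xs ≡ sum (map (𝟙 ∘ p) xs)
  countB≡sum p [] = refl
  countB≡sum p (x ∷ xs) = cong (𝟙 (p x) +_) (countB≡sum p xs)

  countB-↭ : ∀ (p : A → Bool) {xs ys} → xs ↭ ys → countB p xs ≡ countB p ys
  countB-↭ p {xs} {ys} xs↭ys = begin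
    countB p xs          ≡⟨ countB≡sum p xs ⟩
    sum (map (𝟙 ∘ p) xs) ≡⟨ sum-↭ (map⁺ (𝟙 ∘ p) xs↭ys) ⟩
    sum (map (𝟙 ∘ p) ys) ≡⟨ countB≡sum p ys ⟨
    countB p ys          ∎
    where open ≡-Reasoning

module _ {A B : Set} where

  concatMap⁺ : ∀ (f : A → List B) {xs ys} → xs ↭ ys → concatMap f xs ↭ concatMap f ys
  concatMap⁺ f refl = refl
  concatMap⁺ f (prep x p) = ++⁺ˡ (f x) (concatMap⁺ f p)
  concatMap⁺ f (swap x y p) =
    ↭-trans (shifts (f x) (f y)) (++⁺ˡ (f y) (++⁺ˡ (f x) (concatMap⁺ f p)))
  concatMap⁺ f (trans p q) = ↭-trans (concatMap⁺ f p) (concatMap⁺ f q)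

  concatMap-cong-↭ : ∀ {f g : A → List B} {xs} →
                     All (λ x → f x ↭ g x) xs → concatMap f xs ↭ concatMap g xs
  concatMap-cong-↭ [] = refl
  concatMap-cong-↭ {f} {xs = x ∷ _} (fx↭gx ∷ ps) =
    ↭-trans (++⁺ˡ (f x) (concatMap-cong-↭ ps)) (++⁺ʳ _ fx↭gx)

  map-proj₁-zip : ∀ (xs : List A) (ys : List B) →
                  length xs ≡ length ys → map proj₁ (zip xs ys) ≡ xs
  map-proj₁-zip [] [] _ = refl
  map-proj₁-zip (x ∷ xs) (y ∷ ys) eq = cong (x ∷_) (map-proj₁-zip xs ys (suc-injective eq))

  map-proj₂-zip : ∀ (xs : List A) (ys : List B) →
                  length xs ≡ length ys → map proj₂ (zip xs ys) ≡ ys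
  map-proj₂-zip [] [] _ = refl
  map-proj₂-zip (x ∷ xs) (y ∷ ys) eq = cong (y ∷_) (map-proj₂-zip xs ys (suc-injective eq))

majAt : ℕ → List ℕ → ℕ
majAt k [] = 0
majAt k (x ∷ []) = 0
majAt k (x ∷ y ∷ w) = (if x >ᵇ y then k else 0) + majAt (suc k) (y ∷ w)

maj : List ℕ → ℕ
maj = majAt 1

des : List ℕ → ℕ
des [] = 0
des (x ∷ []) = 0
des (x ∷ y ∷ w) = 𝟙 (x >ᵇ y) + des (y ∷ w)

asc : List ℕ → ℕ
asc [] = 0
asc (x ∷ []) = 0
asc (x ∷ y ∷ w) = 𝟙 (not (x >ᵇ y)) + asc (y ∷ w)

inv : List ℕ → ℕ
inv [] = 0
inv (x ∷ w) = countB (x >ᵇ_) w + inv w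

>F-distinct : ∀ (x y : Letter) → proj₁ x ≢ proj₁ y → (x >F y) ≡ proj₁ x >ᵇ proj₁ y
>F-distinct (a , c) (b , d) a≢b rewrite ≡ᵇ-false a≢b = ∨-identityʳ (b <ᵇ a)

majFrom-distinct : ∀ k (w : List Letter) →
                   Unique (map proj₁ w) → majFrom k w ≡ majAt k (map proj₁ w)
majFrom-distinct k [] _ = refl
majFrom-distinct k (_ ∷ []) _ = refl
majFrom-distinct k (x ∷ y ∷ w) ((x≢y ∷ _) ∷ u) rewrite >F-distinct x y x≢y =
  cong ((if proj₁ x >ᵇ proj₁ y then k else 0) +_) (majFrom-distinct (suc k) (y ∷ w) u)

-- invF counts with a where-bound helper that cannot be referred to; cancelling
-- invF w in the induction hypothesis identifies it with countB.
invF-∷ : ∀ x w → invF (x ∷ w) ≡ countB (x >F_) w + invF w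
invF-∷ x [] = refl
invF-∷ x (y ∷ w) =
  cong (λ c → (𝟙 (x >F y) + c) + invF (y ∷ w)) (+-cancelʳ-≡ (invF w) _ _ (invF-∷ x w))

invF-distinct : ∀ (w : List Letter) → Unique (map proj₁ w) → invF w ≡ inv (map proj₁ w)
invF-distinct [] _ = refl
invF-distinct (x ∷ w) (x≢w ∷ u) = begin
  invF (x ∷ w)                                           ≡⟨ invF-∷ x w ⟩
  countB (x >F_) w + invF w                              ≡⟨ cong₂ _+_ below (invF-distinct w u) ⟩
  countB (proj₁ x >ᵇ_) (map proj₁ w) + inv (map proj₁ w) ∎
  where
  open ≡-Reasoning
  below : countB (x >F_) w ≡ countB (proj₁ x >ᵇ_) (map proj₁ w)
  below = ≡-trans (countB-cong-local (All.map (>F-distinct x _) (All.map⁻ x≢w)))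
                  (sym (countB-map (proj₁ x >ᵇ_) proj₁ w))

IsFlagOf : ℕ → (List Letter → ℕ) → (List ℕ → ℕ) → Set
IsFlagOf r s t = ∀ w → Unique (map proj₁ w) → s w ≡ r * t (map proj₁ w) + csum w

flagMajorF-isFlagOf-maj : ∀ r → IsFlagOf r (flagMajorF r) maj
flagMajorF-isFlagOf-maj r w u = cong (λ m → r * m + csum w) (majFrom-distinct 1 w u)

finvF-isFlagOf-inv : ∀ r → IsFlagOf r (finvF r) inv
finvF-isFlagOf-inv r w u = cong (λ m → r * m + csum w) (invF-distinct w u)

IsFlagOf-zip : ∀ {r s t} → IsFlagOf r s t → ∀ π z → Unique π → length π ≡ length z →
               s (zip π z) ≡ r * t π + sum z
IsFlagOf-zip {r} {s} {t} s-flag π z u len = begin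
  s (zip π z)
    ≡⟨ s-flag (zip π z) (subst Unique (sym π-eq) u) ⟩
  r * t (map proj₁ (zip π z)) + sum (map proj₂ (zip π z))
    ≡⟨ cong₂ (λ p c → r * t p + sum c) π-eq (map-proj₂-zip π z len) ⟩
  r * t π + sum z ∎
  where
  open ≡-Reasoning
  π-eq = map-proj₁-zip π z len

range : ℕ → ℕ → List ℕ
range m zero = []
range m (suc k) = m ∷ range (suc m) k

range-++ : ∀ m k l → range m (k + l) ≡ range m k ++ range (m + k) l
range-++ m zero l = cong (λ i → range i l) (sym (+-identityʳ m))
range-++ m (suc k) l =
  cong (m ∷_) (≡-trans (range-++ (suc m) k l)
                       (cong (λ i → range (suc m) k ++ range i l) (sym (+-suc m k))))

range-∷ʳ : ∀ m k → range m (suc k) ≡ range m k ++ [ m + k ]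
range-∷ʳ m k = ≡-trans (cong (range m) (+-comm 1 k)) (range-++ m k 1)

map-+-range : ∀ c m k → map (c +_) (range m k) ≡ range (c + m) k
map-+-range c m zero = refl
map-+-range c m (suc k) =
  cong ((c + m) ∷_) (≡-trans (map-+-range c (suc m) k) (cong (λ i → range i k) (+-suc c m)))

insertions-↭ : ∀ x ys → All (_↭ x ∷ ys) (insertions x ys)
insertions-↭ x [] = refl ∷ []
insertions-↭ x (y ∷ ys) =
  refl ∷ All.map⁺ (All.map (λ v↭ → ↭-trans (prep y v↭) (swap y x refl)) (insertions-↭ x ys))

letters : ℕ → List ℕ
letters = applyDownFrom suc

perms-↭-letters : ∀ n → All (_↭ letters n) (perms n)
perms-↭-letters zero = refl ∷ []
perms-↭-letters (suc n) = All.concat⁺ (All.map⁺ (All.map row (perms-↭-letters n)))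
  where
  row : ∀ {π} → π ↭ letters n → All (_↭ letters (suc n)) (insertions (suc n) π)
  row {π} π↭ = All.map (λ v↭ → ↭-trans v↭ (prep (suc n) π↭)) (insertions-↭ (suc n) π)

module _ {n π} (π↭ : π ↭ letters n) where

  perm-length : length π ≡ n
  perm-length = ≡-trans (↭-length π↭) (length-applyDownFrom suc n)

  perm-unique : Unique π
  perm-unique = Unique-resp-↭ (↭⇒↭ₛ (↭-sym π↭))
    (Unique.applyDownFrom⁺₁ suc n (λ j<i _ → <⇒≢ j<i ∘ sym ∘ suc-injective))

  perm-bounded : All (_< suc n) π
  perm-bounded = All-resp-↭ (↭-sym π↭) (All.applyDownFrom⁺₁ suc n s≤s)

InsertionRange : (List ℕ → ℕ) → Set
InsertionRange s =
  ∀ {x} w → All (_< x) w → map s (insertions x w) ↭ range (s w) (suc (length w))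

countB-below-max : ∀ {x w} → All (_< x) w → countB (x >ᵇ_) w ≡ length w
countB-below-max [] = refl
countB-below-max (y<x ∷ ys<x) rewrite >ᵇ-true y<x = cong suc (countB-below-max ys<x)

countB-insertions : ∀ {x y} ys → y < x →
                    All (λ v → countB (y >ᵇ_) v ≡ countB (y >ᵇ_) ys) (insertions x ys)
countB-insertions {x} {y} ys y<x = All.map below (insertions-↭ x ys)
  where
  below : ∀ {v} → v ↭ x ∷ ys → countB (y >ᵇ_) v ≡ countB (y >ᵇ_) ys
  below v↭ =
    ≡-trans (countB-↭ (y >ᵇ_) v↭) (cong (λ b → 𝟙 b + countB (y >ᵇ_) ys) (>ᵇ-false y<x))

inv-insertionRange : InsertionRange inv
inv-insertionRange [] [] = refl
inv-insertionRange {x} (y ∷ ys) (y<x ∷ ys<x) = begin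
  inv (x ∷ y ∷ ys) ∷ map inv (map (y ∷_) (insertions x ys))
    ≡⟨ cong₂ _∷_ front later ⟩
  (I + suc n) ∷ map (c +_) (map inv (insertions x ys))
    ↭⟨ prep _ (map⁺ (c +_) (inv-insertionRange ys ys<x)) ⟩
  (I + suc n) ∷ map (c +_) (range (inv ys) (suc n))
    ≡⟨ cong ((I + suc n) ∷_) (map-+-range c (inv ys) (suc n)) ⟩
  (I + suc n) ∷ range I (suc n)
    ↭⟨ ∷↭∷ʳ _ _ ⟩
  range I (suc n) ++ [ I + suc n ]
    ≡⟨ range-∷ʳ I (suc n) ⟨
  range I (suc (suc n)) ∎
  where
  open PermutationReasoning
  n = length ys
  I = inv (y ∷ ys)
  c = countB (y >ᵇ_) ys
  front : inv (x ∷ y ∷ ys) ≡ I + suc n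
  front = ≡-trans (cong (_+ I) (countB-below-max (y<x ∷ ys<x))) (+-comm (suc n) I)
  later : map inv (map (y ∷_) (insertions x ys)) ≡ map (c +_) (map inv (insertions x ys))
  later = ≡-trans (sym (map-∘ (insertions x ys)))
    (≡-trans (map-cong-local (All.map (λ {v} → cong (_+ inv v)) (countB-insertions ys y<x)))
             (map-∘ (insertions x ys)))

descentWeight-suc : ∀ e k A D →
             (if e then suc k else 0) + (A + D) ≡ (if e then k else 0) + A + (𝟙 e + D)
descentWeight-suc false k A D = refl
descentWeight-suc true k A D = begin
  suc (k + (A + D))   ≡⟨ cong suc (+-assoc k A D) ⟨
  suc (k + A + D)     ≡⟨ +-suc (k + A) D ⟨
  k + A + suc D       ∎
  where open ≡-Reasoning

majAt-suc : ∀ k w → majAt (suc k) w ≡ majAt k w + des w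
majAt-suc k [] = refl
majAt-suc k (x ∷ []) = refl
majAt-suc k (x ∷ y ∷ w) = ≡-trans (cong (_ +_) (majAt-suc (suc k) (y ∷ w)))
                                  (descentWeight-suc (x >ᵇ y) k (majAt (suc k) (y ∷ w)) (des (y ∷ w)))

majDes : List ℕ → ℕ × ℕ
majDes w = maj w , des w

prepend : Bool → ℕ × ℕ → ℕ × ℕ
prepend e (m , d) = 𝟙 e + (m + d) , 𝟙 e + d

majDes-∷-∷ : ∀ y z u → majDes (y ∷ z ∷ u) ≡ prepend (y >ᵇ z) (majDes (z ∷ u))
majDes-∷-∷ y z u =
  cong (λ m → 𝟙 (y >ᵇ z) + m , 𝟙 (y >ᵇ z) + des (z ∷ u)) (majAt-suc 1 (z ∷ u))

map-majDes-∷-∷ : ∀ y z vs → map majDes (map (y ∷_) (map (z ∷_) vs))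
                            ≡ map (prepend (y >ᵇ z)) (map majDes (map (z ∷_) vs))
map-majDes-∷-∷ y z [] = refl
map-majDes-∷-∷ y z (v ∷ vs) = cong₂ _∷_ (majDes-∷-∷ y z v) (map-majDes-∷-∷ y z vs)

block : ℕ → ℕ → ℕ → List (ℕ × ℕ)
block m d zero = []
block m d (suc k) = (m , d) ∷ block (suc m) d k

map-proj₁-block : ∀ m d k → map proj₁ (block m d k) ≡ range m k
map-proj₁-block m d zero = refl
map-proj₁-block m d (suc k) = cong (m ∷_) (map-proj₁-block (suc m) d k)

block-∷ʳ : ∀ m d k → block m d (suc k) ≡ block m d k ++ [ (m + k , d) ]
block-∷ʳ m d zero = cong (λ i → [ (i , d) ]) (sym (+-identityʳ m))
block-∷ʳ m d (suc k) =
  cong ((m , d) ∷_) (≡-trans (block-∷ʳ (suc m) d k)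
                             (cong (λ i → block (suc m) d k ++ [ (i , d) ]) (sym (+-suc m k))))

map-prepend-block : ∀ e m d k →
                    map (prepend e) (block m d k) ≡ block (𝟙 e + (m + d)) (𝟙 e + d) k
map-prepend-block e m d zero = refl
map-prepend-block e m d (suc k) =
  cong (_ ∷_) (≡-trans (map-prepend-block e (suc m) d k)
                       (cong (λ i → block i (𝟙 e + d) k) (+-suc (𝟙 e) (m + d))))

-- The values of (maj, des) after inserting a new largest letter into the slots
-- behind the first letter of a word with major index M, d descents and a
-- ascents: the d + 1 slots at the end and inside descents give M, …, M + d and
-- no new descent, the a slots inside ascents give M + d + 2, …, M + d + 1 + a
-- and one new descent.  The front slot gives the missing M + d + 1.
profile : ℕ → ℕ → ℕ → List (ℕ × ℕ)
profile M d a = block M d (suc d) ++ block (suc (suc (M + d))) (suc d) a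

map-prepend-profile : ∀ e M d a →
  map (prepend e) (profile M d a)
    ≡ block (𝟙 e + (M + d)) (𝟙 e + d) (suc d)
      ++ block (𝟙 e + (suc (suc (M + d)) + suc d)) (𝟙 e + suc d) a
map-prepend-profile e M d a = ≡-trans (map-++ (prepend e) (block M d (suc d)) _)
  (cong₂ _++_ (map-prepend-block e M d (suc d)) (map-prepend-block e (suc (suc (M + d))) (suc d) a))

prepend-profile : ∀ e M d a →
  prepend false (prepend true (M , d)) ∷ map (prepend e) (profile M d a)
    ↭ profile (𝟙 e + (M + d)) (𝟙 e + d) (𝟙 (not e) + a)
prepend-profile false M d a = begin
  peak ∷ map (prepend false) (profile M d a)  ≡⟨ cong (peak ∷_) (map-prepend-profile false M d a) ⟩
  peak ∷ X ++ block (suc h) (suc d) a         ↭⟨ shift peak X _ ⟨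
  X ++ block h (suc d) (suc a)                ≡⟨ cong (λ i → X ++ block i (suc d) (suc a)) h≡ ⟩
  profile (M + d) d (suc a)                   ∎
  where
  open PermutationReasoning
  peak = prepend false (prepend true (M , d))
  h = proj₁ peak
  X = block (M + d) d (suc d)
  h≡ : h ≡ suc (suc (M + d + d))
  h≡ = cong suc (+-suc (M + d) d)
prepend-profile true M d a = begin
  peak ∷ map (prepend true) (profile M d a)    ≡⟨ cong (peak ∷_) (map-prepend-profile true M d a) ⟩
  peak ∷ X ++ Y                                ↭⟨ shift peak X Y ⟨
  X ++ [ peak ] ++ Y                           ≡⟨ ++-assoc X [ peak ] Y ⟨
  (X ++ [ peak ]) ++ Y                         ≡⟨ cong (_++ Y) (block-∷ʳ (suc (M + d)) (suc d) (suc d)) ⟨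
  profile (suc (M + d)) (suc d) a              ∎
  where
  open PermutationReasoning
  peak = prepend false (prepend true (M , d))
  X = block (suc (M + d)) (suc d) (suc d)
  Y = block (suc (suc (suc (M + d) + suc d))) (suc (suc d)) a

majDes-laterInsertions : ∀ {x} y ys → All (_< x) (y ∷ ys) →
  map majDes (map (y ∷_) (insertions x ys)) ↭ profile (maj (y ∷ ys)) (des (y ∷ ys)) (asc (y ∷ ys))
majDes-laterInsertions y [] (y<x ∷ []) rewrite >ᵇ-false y<x = refl
majDes-laterInsertions {x} y (z ∷ zs) (y<x ∷ z<x ∷ zs<x) = begin
  majDes (y ∷ x ∷ z ∷ zs) ∷ map majDes (map (y ∷_) (map (z ∷_) (insertions x zs)))
    ≡⟨ cong₂ _∷_ peak (map-majDes-∷-∷ y z (insertions x zs)) ⟩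
  prepend false (prepend true (M , d)) ∷ map (prepend e) (map majDes (map (z ∷_) (insertions x zs)))
    ↭⟨ prep _ (map⁺ (prepend e) (majDes-laterInsertions z zs (z<x ∷ zs<x))) ⟩
  prepend false (prepend true (M , d)) ∷ map (prepend e) (profile M d a)
    ↭⟨ prepend-profile e M d a ⟩
  profile (𝟙 e + (M + d)) (𝟙 e + d) (𝟙 (not e) + a)
    ≡⟨ cong (λ m → profile m (𝟙 e + d) (𝟙 (not e) + a)) (cong proj₁ (majDes-∷-∷ y z zs)) ⟨
  profile (maj (y ∷ z ∷ zs)) (des (y ∷ z ∷ zs)) (asc (y ∷ z ∷ zs)) ∎
  where
  open PermutationReasoning
  e = y >ᵇ z
  M = maj (z ∷ zs)
  d = des (z ∷ zs)
  a = asc (z ∷ zs)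
  peak : majDes (y ∷ x ∷ z ∷ zs) ≡ prepend false (prepend true (M , d))
  peak = ≡-trans (majDes-∷-∷ y x (z ∷ zs))
           (cong₂ prepend (>ᵇ-false y<x)
                  (≡-trans (majDes-∷-∷ x z zs) (cong (λ b → prepend b (M , d)) (>ᵇ-true z<x))))

length≡1+des+asc : ∀ y ys → length (y ∷ ys) ≡ suc (des (y ∷ ys) + asc (y ∷ ys))
length≡1+des+asc y [] = refl
length≡1+des+asc y (z ∷ zs) with y >ᵇ z
... | true = cong suc (length≡1+des+asc z zs)
... | false = cong suc (≡-trans (length≡1+des+asc z zs) (sym (+-suc _ _)))

maj-insertionRange : InsertionRange maj
maj-insertionRange [] [] = refl
maj-insertionRange {x} (y ∷ ys) (y<x ∷ ys<x) = begin
  maj (x ∷ y ∷ ys) ∷ map maj (map (y ∷_) (insertions x ys))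
    ≡⟨ cong₂ _∷_ front (map-∘ (map (y ∷_) (insertions x ys))) ⟩
  suc (M + d) ∷ map proj₁ (map majDes (map (y ∷_) (insertions x ys)))
    ↭⟨ prep _ (map⁺ proj₁ (majDes-laterInsertions y ys (y<x ∷ ys<x))) ⟩
  suc (M + d) ∷ map proj₁ (profile M d a)
    ≡⟨ cong (suc (M + d) ∷_) (≡-trans (map-++ proj₁ (block M d (suc d)) _)
         (cong₂ _++_ (map-proj₁-block M d (suc d)) (map-proj₁-block _ (suc d) a))) ⟩
  suc (M + d) ∷ range M (suc d) ++ range (suc (suc (M + d))) a
    ↭⟨ shift (suc (M + d)) (range M (suc d)) _ ⟨
  range M (suc d) ++ range (suc (M + d)) (suc a)
    ≡⟨ cong (λ i → range M (suc d) ++ range i (suc a)) (+-suc M d) ⟨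
  range M (suc d) ++ range (M + suc d) (suc a)
    ≡⟨ range-++ M (suc d) (suc a) ⟨
  range M (suc (d + suc a))
    ≡⟨ cong (range M ∘ suc) (≡-trans (+-suc d a) (sym (length≡1+des+asc y ys))) ⟩
  range M (suc (length (y ∷ ys))) ∎
  where
  open PermutationReasoning
  M = maj (y ∷ ys)
  d = des (y ∷ ys)
  a = asc (y ∷ ys)
  front : maj (x ∷ y ∷ ys) ≡ suc (M + d)
  front =
    cong proj₁ (≡-trans (majDes-∷-∷ x y ys) (cong (λ b → prepend b (M , d)) (>ᵇ-true y<x)))

mahonian : ℕ → List ℕ
mahonian zero = [ 0 ]
mahonian (suc n) = concatMap (λ m → range m (suc n)) (mahonian n)

mahonian-distribution : ∀ s → s [] ≡ 0 → InsertionRange s → ∀ n → map s (perms n) ↭ mahonian n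
mahonian-distribution s s[]≡0 s-range zero = ↭-reflexive (cong [_] s[]≡0)
mahonian-distribution s s[]≡0 s-range (suc n) = begin
  map s (concatMap (insertions (suc n)) (perms n))
    ≡⟨ map-concatMap s (insertions (suc n)) (perms n) ⟩
  concatMap (map s ∘ insertions (suc n)) (perms n)
    ↭⟨ concatMap-cong-↭ (All.map row (perms-↭-letters n)) ⟩
  concatMap (λ π → range (s π) (suc n)) (perms n)
    ≡⟨ concatMap-map (λ m → range m (suc n)) s (perms n) ⟨
  concatMap (λ m → range m (suc n)) (map s (perms n))
    ↭⟨ concatMap⁺ (λ m → range m (suc n)) (mahonian-distribution s s[]≡0 s-range n) ⟩
  mahonian (suc n) ∎
  where
  open PermutationReasoning
  row : ∀ {π} → π ↭ letters n → map s (insertions (suc n) π) ↭ range (s π) (suc n)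
  row {π} π↭ = subst (λ k → map s (insertions (suc n) π) ↭ range (s π) (suc k))
                     (perm-length π↭) (s-range π (perm-bounded π↭))

macMahon : ∀ n → map maj (perms n) ↭ map inv (perms n)
macMahon n = ↭-trans (mahonian-distribution maj refl maj-insertionRange n)
                     (↭-sym (mahonian-distribution inv refl inv-insertionRange n))

colorings-length : ∀ r n → All (λ z → length z ≡ n) (colorings r n)
colorings-length r zero = refl ∷ []
colorings-length r (suc n) =
  All.concat⁺ (All.map⁺ (All.universal (λ _ → All.map⁺ (All.map (cong suc) (colorings-length r n)))
                                        (upTo r)))

flagValues : ℕ → ℕ → ℕ → List ℕ
flagValues r n m = map (λ z → r * m + sum z) (colorings r n)

map-G : ∀ {r s t} n → IsFlagOf r s t →
        map s (G r n) ≡ concatMap (flagValues r n) (map t (perms n))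
map-G {r} {s} {t} n s-flag = begin
  map s (G r n)
    ≡⟨ map-concatMap s (λ π → map (zip π) (colorings r n)) (perms n) ⟩
  concatMap (λ π → map s (map (zip π) (colorings r n))) (perms n)
    ≡⟨ cong concat (map-cong-local (All.map row (perms-↭-letters n))) ⟩
  concatMap (flagValues r n ∘ t) (perms n)
    ≡⟨ concatMap-map (flagValues r n) t (perms n) ⟨
  concatMap (flagValues r n) (map t (perms n)) ∎
  where
  open ≡-Reasoning
  row : ∀ {π} → π ↭ letters n → map s (map (zip π) (colorings r n)) ≡ flagValues r n (t π)
  row {π} π↭ =
    ≡-trans (sym (map-∘ (colorings r n))) (map-cong-local (All.map entry (colorings-length r n)))
    where
    entry : ∀ {z} → length z ≡ n → s (zip π z) ≡ r * t π + sum z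
    entry {z} len =
      IsFlagOf-zip {r} {s} {t} s-flag π z (perm-unique π↭) (≡-trans (perm-length π↭) (sym len))

flagMajorF↭finvF : ∀ r n → map (flagMajorF r) (G r n) ↭ map (finvF r) (G r n)
flagMajorF↭finvF r n = begin
  map (flagMajorF r) (G r n)                        ≡⟨ map-G n (flagMajorF-isFlagOf-maj r) ⟩
  concatMap (flagValues r n) (map maj (perms n))    ↭⟨ concatMap⁺ (flagValues r n) (macMahon n) ⟩
  concatMap (flagValues r n) (map inv (perms n))    ≡⟨ map-G n (finvF-isFlagOf-inv r) ⟨
  map (finvF r) (G r n)                             ∎
  where open PermutationReasoning

mainTheorem19 : (r n : ℕ) → .{{_ : NonZero r}} → .{{_ : NonZero n}} → (k : ℕ) → genCoeff r n (flagMajorF r) k ≡ genCoeff r n (finvF r) k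
mainTheorem19 r n k = begin
  genCoeff r n (flagMajorF r) k                  ≡⟨ countB-map (_≡ᵇ k) (flagMajorF r) (G r n) ⟨
  countB (_≡ᵇ k) (map (flagMajorF r) (G r n))    ≡⟨ countB-↭ (_≡ᵇ k) (flagMajorF↭finvF r n) ⟩
  countB (_≡ᵇ k) (map (finvF r) (G r n))         ≡⟨ countB-map (_≡ᵇ k) (finvF r) (G r n) ⟩
  genCoeff r n (finvF r) k                       ∎
  where open ≡-Reasoning
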